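{- Let $G$ be a graph, $s,t$ vertices and $k\ge 1$. The inclusion-minimal $(s,t)$-paths of length $k$ in $G$ are exactly the paths $\pi,t$ (the path $\pi$ followed by the vertex $t$) where $\pi$ is an inclusion-minimal $(s,t')$-path of length $k-1$, $t'$ is a neighbour of $t$, and no vertex of $\pi$ other than $t'$ is adjacent to $t$.
   Context: A path $v_0,v_1,\dots,v_k$ in a graph $G$ is inclusion-minimal if no proper subset of $\{v_0,\dots,v_k\}$ forms a path from $v_0$ to $v_k$. The length of the path is $k$. -}

module Defs where

open import Level using (Level; suc; _⊔_)
open import Data.Nat using (ℕ; _∸_)
open import Data.List using (List; []; _∷_; [_]; length)
open import Data.List.Relation.Unary.Unique.Propositional using (Unique)
open import Data.List.Relation.Binary.Subset.Propositional using (_⊆_)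
open import Data.Product using (Σ; _×_; ∃-syntax)
open import Relation.Binary.PropositionalEquality using (_≡_)
open import Relation.Nullary using (¬_)

record Graph (a ℓ : Level) : Set (Level.suc (a ⊔ ℓ)) where
  field
    V      : Set a
    Adj    : V → V → Set ℓ
    sym    : ∀ {u v} → Adj u v → Adj v u
    irrefl : ∀ {v} → ¬ Adj v v

module _ {a ℓ} (G : Graph a ℓ) where
  open Graph G

  data Walk : V → V → List V → Set (a ⊔ ℓ) where
    single : ∀ v → Walk v v [ v ]
    step   : ∀ {u v t p} → Adj u v → Walk v t p → Walk u t (u ∷ p)

  IsPath : V → V → List V → Set (a ⊔ ℓ)
  IsPath s t p = Walk s t p × Unique p

  IsMinPath : V → V → List V → Set (a ⊔ ℓ)
  IsMinPath s t p =
    IsPath s t p ×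
    ¬ (∃[ q ] (IsPath s t q × q ⊆ p × ¬ (p ⊆ q)))

-- length of a path given by its vertex list v₀,…,v_k is k
pathLength : ∀ {a} {A : Set a} → List A → ℕ
pathLength p = length p ∸ 1

-- Removing the last vertex t of a minimal (s,t)-path p = π t leaves a minimal
-- (s,t′)-path π: a proper (s,t′)-subpath q of π would give the proper
-- (s,t)-subpath q t of p. If some v ≠ t′ on π were adjacent to t, the prefix
-- of π up to v followed by t would be an (s,t)-path avoiding t′. Conversely,
-- if π is minimal and t′ is the only neighbour of t on π, any (s,t)-path
-- q t′′ t inside π t has t′′ ∈ π adjacent to t, so t′′ = t′ and q t′′ is an
-- (s,t′)-path inside π, hence all of π.
module Submission where

open import Defs
open import Data.Nat using (ℕ; _≤_; _∸_; zero; suc)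
open import Data.List using (List; []; _∷_; [_]; _++_; _∷ʳ_; length)
open import Data.List.Properties using (length-++-comm)
open import Data.List.Membership.Propositional using (_∈_; _∉_)
open import Data.List.Membership.Propositional.Properties using (∈-++⁻)
open import Data.List.Relation.Unary.Any using (here; there)
open import Data.List.Relation.Unary.All using ([]; _∷_; lookup)
import Data.List.Relation.Unary.All.Properties as All
open import Data.List.Relation.Unary.AllPairs using ([]; _∷_)
open import Data.List.Relation.Unary.Unique.Propositional using (Unique)
open import Data.List.Relation.Unary.Unique.Propositional.Properties as Unique using ()
open import Data.List.Relation.Binary.Disjoint.Propositional using (Disjoint)
open import Data.List.Relation.Binary.Subset.Propositional using (_⊆_)
open import Data.List.Relation.Binary.Subset.Propositional.Properties
  using (xs⊆xs++ys; xs⊆ys++xs; ++⁺ˡ)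
open import Level using (_⊔_)
open import Data.Product using (_×_; ∃-syntax; ∃₂; _,_; proj₁; proj₂)
open import Data.Sum using (inj₁; inj₂)
open import Function.Base using (_∘_)
open import Function.Bundles using (_⇔_; mk⇔)
open import Relation.Binary.PropositionalEquality using (_≡_; _≢_; refl; sym; trans; cong)
open import Relation.Nullary using (¬_; contradiction)

module _ {a} {A : Set a} where

  infix 4 _⊂_

  _⊂_ : List A → List A → Set a
  xs ⊂ ys = xs ⊆ ys × ¬ ys ⊆ xs

  Unique-++⁻ : ∀ xs {ys : List A} → Unique (xs ++ ys) → Unique xs × Disjoint xs ys
  Unique-++⁻ [] _ = [] , λ ()
  Unique-++⁻ (x ∷ xs) (x∉ ∷ u) with Unique-++⁻ xs u
  ... | uxs , xs#ys = All.++⁻ˡ xs x∉ ∷ uxs , λ where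
    (here refl , x∈ys) → lookup x∉ (xs⊆ys++xs _ xs x∈ys) refl
    (there v∈xs , v∈ys) → xs#ys (v∈xs , v∈ys)

  Unique-∷ʳ⁻ : ∀ xs {x : A} → Unique (xs ∷ʳ x) → Unique xs × x ∉ xs
  Unique-∷ʳ⁻ xs u with Unique-++⁻ xs u
  ... | uxs , xs#x = uxs , λ x∈xs → xs#x (x∈xs , here refl)

  Unique-∷ʳ⁺ : ∀ {xs} {x : A} → Unique xs → x ∉ xs → Unique (xs ∷ʳ x)
  Unique-∷ʳ⁺ uxs x∉xs = Unique.++⁺ uxs ([] ∷ []) λ where (x∈xs , here refl) → x∉xs x∈xs

  ⊆∷ʳ∧∉⇒⊆ : ∀ {xs ys} {y : A} → xs ⊆ ys ∷ʳ y → y ∉ xs → xs ⊆ ys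
  ⊆∷ʳ∧∉⇒⊆ {ys = ys} xs⊆ys∷ʳy y∉xs x∈xs with ∈-++⁻ ys (xs⊆ys∷ʳy x∈xs)
  ... | inj₁ x∈ys = x∈ys
  ... | inj₂ (here refl) = contradiction x∈xs y∉xs

  ⊂-∷ʳ⁺ : ∀ {xs ys} {y : A} → y ∉ ys → xs ⊂ ys → xs ∷ʳ y ⊂ ys ∷ʳ y
  ⊂-∷ʳ⁺ {ys = ys} {y} y∉ys (xs⊆ys , ys⊈xs) =
    ++⁺ˡ [ y ] xs⊆ys , λ h → ys⊈xs (⊆∷ʳ∧∉⇒⊆ (h ∘ xs⊆xs++ys ys [ y ]) y∉ys)

  ⊂-∷ʳ⁻ : ∀ {xs ys} {y : A} → y ∉ xs → xs ∷ʳ y ⊂ ys ∷ʳ y → xs ⊂ ys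
  ⊂-∷ʳ⁻ {xs} {ys} {y} y∉xs (h , ys∷ʳy⊈xs∷ʳy) =
    ⊆∷ʳ∧∉⇒⊆ (h ∘ xs⊆xs++ys xs [ y ]) y∉xs , ys∷ʳy⊈xs∷ʳy ∘ ++⁺ˡ [ y ]

  pathLength-∷ʳ : ∀ (xs : List A) x → pathLength (xs ∷ʳ x) ≡ length xs
  pathLength-∷ʳ xs x = cong (_∸ 1) (length-++-comm xs [ x ])

module _ {a ℓ} (G : Graph a ℓ) where
  open Graph G using (V; Adj)

  private variable
    s t t′ v : V
    p π q : List V

  walk-head∈ : Walk G s t p → s ∈ p
  walk-head∈ (single _) = here refl
  walk-head∈ (step _ _) = here refl

  walk-last∈ : Walk G s t p → t ∈ p
  walk-last∈ (single _) = here refl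
  walk-last∈ (step _ w) = there (walk-last∈ w)

  walk-length : Walk G s t p → length p ≡ suc (pathLength p)
  walk-length (single _) = refl
  walk-length (step _ _) = refl

  walk-∷ʳ : Walk G s t′ π → Adj t′ t → Walk G s t (π ∷ʳ t)
  walk-∷ʳ (single _) t′t = step t′t (single _)
  walk-∷ʳ (step uv w) t′t = step uv (walk-∷ʳ w t′t)

  data Walkʳ : V → V → List V → Set (a ⊔ ℓ) where
    single : ∀ v → Walkʳ v v [ v ]
    snoc   : Walk G s t′ π → Adj t′ t → Walkʳ s t (π ∷ʳ t)

  walkʳ : Walk G s t p → Walkʳ s t p
  walkʳ (single v) = single v
  walkʳ (step {u} uv w) with walkʳ w
  ... | single _ = snoc (single u) uv
  ... | snoc w′ t′t = snoc (step uv w′) t′t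

  walk-splitAt : Walk G s t p → v ∈ p →
    ∃₂ λ ρ σ → p ≡ ρ ++ σ × Walk G s v ρ × Walk G v t (v ∷ σ)
  walk-splitAt (single v) (here refl) = [ v ] , [] , refl , single v , single v
  walk-splitAt {s} (step uv w) (here refl) = [ s ] , _ , refl , single s , step uv w
  walk-splitAt {s} (step uv w) (there v∈p) with walk-splitAt w v∈p
  ... | ρ , σ , refl , wρ , wσ = s ∷ ρ , σ , refl , step uv wρ , wσ

  path-∷ʳ : IsPath G s t′ π → Adj t′ t → t ∉ π → IsPath G s t (π ∷ʳ t)
  path-∷ʳ (w , u) t′t t∉π = walk-∷ʳ w t′t , Unique-∷ʳ⁺ u t∉π

  path-shortcut : IsPath G s t (π ∷ʳ t) → Walk G s t′ π → v ∈ π → v ≢ t′ → Adj v t →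
    ∃[ q ] (IsPath G s t q × q ⊂ π ∷ʳ t)
  path-shortcut {t = t} {t′ = t′} (_ , u) w v∈π v≢t′ vt with walk-splitAt w v∈π
  ... | ρ , σ , refl , wρ , wσ with Unique-∷ʳ⁻ (ρ ++ σ) u
  ... | uπ , t∉π with Unique-++⁻ ρ uπ
  ... | uρ , ρ#σ =
    ρ ∷ʳ t , path-∷ʳ (wρ , uρ) vt (t∉π ∘ xs⊆xs++ys ρ σ) , ⊂-∷ʳ⁺ t∉π (xs⊆xs++ys ρ σ , π⊈ρ)
    where
    t′∈σ : t′ ∈ σ
    t′∈σ with walk-last∈ wσ
    ... | here t′≡v = contradiction (sym t′≡v) v≢t′
    ... | there t′∈σ = t′∈σ

    π⊈ρ : ¬ ρ ++ σ ⊆ ρ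
    π⊈ρ π⊆ρ = ρ#σ (π⊆ρ (xs⊆ys++xs σ ρ t′∈σ) , t′∈σ)

  minPath-∷ʳ⁻ : IsMinPath G s t (π ∷ʳ t) → Walk G s t′ π → Adj t′ t → IsMinPath G s t′ π
  minPath-∷ʳ⁻ {π = π} ((_ , u) , minimal) w t′t with Unique-∷ʳ⁻ π u
  ... | uπ , t∉π = (w , uπ) , λ where
    (q , qpath , q⊂π) →
      minimal (q ∷ʳ _ , path-∷ʳ qpath t′t (t∉π ∘ proj₁ q⊂π) , ⊂-∷ʳ⁺ t∉π q⊂π)

  minPath-∷ʳ-nonadjacent : IsMinPath G s t (π ∷ʳ t) → Walk G s t′ π →
    ∀ v → v ∈ π → v ≢ t′ → ¬ Adj v t
  minPath-∷ʳ-nonadjacent (path , minimal) w _ v∈π v≢t′ vt =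
    minimal (path-shortcut path w v∈π v≢t′ vt)

  ∷ʳ-no-proper-subpath : IsPath G s t (π ∷ʳ t) → IsMinPath G s t′ π →
    (∀ v → v ∈ π → v ≢ t′ → ¬ Adj v t) →
    IsPath G s t q → ¬ q ⊂ π ∷ʳ t
  ∷ʳ-no-proper-subpath {π = π} {t′ = t′} (_ , u) ((wπ , _) , minimal) nonadjacent (wq , uq) q⊂π∷ʳt
    with walkʳ wq
  ... | single _ = proj₂ (Unique-∷ʳ⁻ π u) (walk-head∈ wπ)
  ... | snoc {t′ = x} {π = q′} wq′ xt with Unique-∷ʳ⁻ q′ uq
  ... | uq′ , t∉q′ = nonadjacent x x∈π x≢t′ xt
    where
    q′⊂π : q′ ⊂ π
    q′⊂π = ⊂-∷ʳ⁻ t∉q′ q⊂π∷ʳt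

    x∈π : x ∈ π
    x∈π = proj₁ q′⊂π (walk-last∈ wq′)

    x≢t′ : x ≢ t′
    x≢t′ refl = minimal (q′ , (wq′ , uq′) , q′⊂π)

  minPath-∷ʳ⁺ : IsPath G s t (π ∷ʳ t) → IsMinPath G s t′ π →
    (∀ v → v ∈ π → v ≢ t′ → ¬ Adj v t) → IsMinPath G s t (π ∷ʳ t)
  minPath-∷ʳ⁺ path minπ nonadjacent = path , λ where
    (q , qpath , q⊂) → ∷ʳ-no-proper-subpath path minπ nonadjacent qpath q⊂

lemma7 : ∀ {a ℓ} (G : Graph a ℓ) (s t : Graph.V G) (k : ℕ) → 1 ≤ k →
    (p : List (Graph.V G)) →
    (IsMinPath G s t p × pathLength p ≡ k)
      ⇔ (∃[ π ] ∃[ t′ ] (p ≡ π ++ [ t ] × IsPath G s t (π ++ [ t ])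
           × IsMinPath G s t′ π × pathLength π ≡ k ∸ 1
           × Graph.Adj G t′ t
           × (∀ v → v ∈ π → v ≢ t′ → ¬ Graph.Adj G v t)))
lemma7 G s t zero () p
lemma7 {a} {ℓ} G s t (suc k) _ p = mk⇔ forward backward
  where
  open Graph G using (Adj)

  Decomposition : Set (a ⊔ ℓ)
  Decomposition = ∃[ π ] ∃[ t′ ] (p ≡ π ++ [ t ] × IsPath G s t (π ++ [ t ])
    × IsMinPath G s t′ π × pathLength π ≡ k × Adj t′ t
    × (∀ v → v ∈ π → v ≢ t′ → ¬ Adj v t))

  forward : IsMinPath G s t p × pathLength p ≡ suc k → Decomposition
  forward (minp@((w , _) , _) , len) with walkʳ G w
  forward (_ , ()) | single _
  ... | snoc {π = π} wπ t′t =
    π , _ , refl , proj₁ minp , minPath-∷ʳ⁻ G minp wπ t′t ,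
    cong (_∸ 1) (trans (sym (pathLength-∷ʳ π t)) len) , t′t ,
    minPath-∷ʳ-nonadjacent G minp wπ

  backward : Decomposition → IsMinPath G s t p × pathLength p ≡ suc k
  backward (π , _ , refl , path , minπ@((wπ , _) , _) , len , _ , nonadjacent) =
    minPath-∷ʳ⁺ G path minπ nonadjacent ,
    trans (pathLength-∷ʳ π t) (trans (walk-length G wπ) (cong suc len))
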